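{- Let $\Gamma\vdash t:\sigma$ be a System T term, let $\gamma_1$ assign to each $(x:\tau)\in\Gamma$ an element $\gamma_1(x)\in\mathcal{B}[\![\tau]\!]$, and let $\gamma_2$ be a family assigning to each System T type $A$ a closed substitution $\gamma_{2,A}$ mapping each $(x:\tau)\in\Gamma$ to a closed term of type $\lceil\tau\rceil_A$. If for every $(x:\tau)\in\Gamma$ we have $R_\tau(\gamma_1(x),(\gamma_{2,A}(x))_A)$, then $R_\sigma(\mathcal{B}[\![t]\!]\gamma_1,\;(\lceil t\rceil_A[\gamma_{2,A}])_A)$, where $\lceil t\rceil_A[\gamma_{2,A}]$ denotes capture-avoiding substitution.
   Context: Metatheory: constructive Martin-Löf type theory without function extensionality; $\mathsf{Natrec}\,f\,x\,0=x$, $\mathsf{Natrec}\,f\,x\,(n+1)=f\,n\,(\mathsf{Natrec}\,f\,x\,n)$. System T: types from base $\iota$ and $\sigma\Rightarrow\tau$; terms in a context: variables, $\mathsf{zero}:\iota$, $\mathsf{succ}\,t$, $\mathsf{rec}_\sigma\,t\,p\,q:\sigma$ ($t:\iota\Rightarrow\sigma\Rightarrow\sigma$, $p:\sigma$, $q:\iota$), $\lambda x{:}\sigma.t$, application. Set interpretation $[\![\iota]\!]=\mathbb{N}$, $[\![\sigma\Rightarrow\tau]\!]=[\![\sigma]\!]\to[\![\tau]\!]$, standard on terms ($\mathsf{rec}$ via $\mathsf{Natrec}$). Hereditarily extensional equality: $n\approx_\iota m$ iff $n=m$; $f\approx_{\sigma_1\Rightarrow\sigma_2}g$ iff $\forall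 x,y$, $x\approx y\Rightarrow f\,x\approx g\,y$. Dialogue trees $\mathcal{D}_{\mathbb N}\mathbb{N}$: inductive, constructors $\eta\,n$ and $\beta\,\varphi\,i$ ($\varphi:\mathbb{N}\to\mathcal{D}_{\mathbb N}\mathbb{N}$). Kleisli $f^\sharp(\eta\,x)=f\,x$, $f^\sharp(\beta\,\varphi\,i)=\beta(\lambda o.f^\sharp(\varphi\,o))\,i$; $\mathsf{map}\,f=(\eta\circ f)^\sharp$. $\mathcal{B}[\![\iota]\!]=\mathcal{D}_{\mathbb N}\mathbb{N}$, $\mathcal{B}[\![\sigma\Rightarrow\tau]\!]=\mathcal{B}[\![\sigma]\!]\to\mathcal{B}[\![\tau]\!]$; $\mathsf{ext}_\iota\,f\,d=f^\sharp d$, $\mathsf{ext}_{\sigma_1\Rightarrow\sigma_2}f\,d\,s=\mathsf{ext}_{\sigma_2}(\lambda x.f\,x\,s)\,d$. $\mathcal{B}[\![x]\!]\gamma=\gamma(x)$, $\mathcal{B}[\![\mathsf{zero}]\!]\gamma=\eta\,0$, $\mathcal{B}[\![\mathsf{succ}\,t]\!]\gamma=\mathsf{map}(\lambda n.n+1)(\mathcal{B}[\![t]\!]\gamma)$, $\mathcal{B}[\![\mathsf{rec}_\sigma t_1t_2t_3]\!]\gamma=\mathsf{ext}_\sigma(\mathsf{Natrec}(\mathcal{B}[\![t_1]\!]\gamma\circ\eta)(\mathcal{B}[\![t_2]\!]\gamma))(\mathcal{B}[\![t_3]\!]\gamma)$, $\mathcal{B}[\![\lambda x.t]\!]\gamma=\lambda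 a.\mathcal{B}[\![t]\!](\gamma,x\mapsto a)$, $\mathcal{B}[\![t\,p]\!]\gamma=\mathcal{B}[\![t]\!]\gamma(\mathcal{B}[\![p]\!]\gamma)$. Internal translation, for a System T type $A$: $\mathsf{ChD}_A(\sigma):=(\sigma\Rightarrow A)\Rightarrow((\iota\Rightarrow A)\Rightarrow\iota\Rightarrow A)\Rightarrow A$; $\eta_A:=\lambda z\,e\,b.\,e\,z$; $\beta_A:=\lambda\varphi\,x\,e\,b.\,b\,(\lambda y.\varphi\,y\,e\,b)\,x$; $K_A:=\lambda f\,d\,e'\,b'.\,d\,(\lambda x.f\,x\,e'\,b')\,b'$; $\mathsf{map}_A:=\lambda f.K_A(\lambda x.\eta_A(f\,x))$. $\lceil\iota\rceil_A=\mathsf{ChD}_A(\iota)$, $\lceil\sigma\Rightarrow\tau\rceil_A=\lceil\sigma\rceil_A\Rightarrow\lceil\tau\rceil_A$, contexts pointwise. $\mathsf{ext}^T_{\iota,A}:=K_A$, $\mathsf{ext}^T_{\sigma_1\Rightarrow\sigma_2,A}:=\lambda f\,d\,s.\mathsf{ext}^T_{\sigma_2,A}(\lambda x.f\,x\,s)\,d$. $\lceil x\rceil_A=x$, $\lceil\mathsf{zero}\rceil_A=\eta_A\,\mathsf{zero}$, $\lceil\mathsf{succ}\,t\rceil_A=\mathsf{map}_A(\lambda n.\mathsf{succ}\,n)\lceil t\rceil_A$, $\lceil\mathsf{rec}_\sigma t_1t_2t_3\rceil_A=\mathsf{ext}^T_{\sigma,A}(\lambda n.\mathsf{rec}_{\lceil\sigma\rceil_A}(\lambda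 x.\lceil t_1\rceil_A(\eta_A x))\lceil t_2\rceil_A\,n)\lceil t_3\rceil_A$, $\lceil\lambda x.t\rceil_A=\lambda x.\lceil t\rceil_A$, $\lceil t\,p\rceil_A=\lceil t\rceil_A\lceil p\rceil_A$. Encoding $\mathsf{enc}_A:\mathcal{D}_{\mathbb N}\mathbb{N}\to[\![\mathsf{ChD}_A(\iota)]\!]$: $\mathsf{enc}_A(\eta\,z)=[\![\eta_A]\!]z$, $\mathsf{enc}_A(\beta\,\varphi\,x)=[\![\beta_A]\!](\mathsf{enc}_A\circ\varphi)\,x$. Logical relation for $x\in\mathcal{B}[\![\sigma]\!]$ and families $y$ of closed terms $y_A:\lceil\sigma\rceil_A$: $R_\iota(d,t)$ iff $\forall A$, $\mathsf{enc}_A(d)\approx[\![t_A]\!]$; $R_{\sigma_1\Rightarrow\sigma_2}(f,g)$ iff for all $x\in\mathcal{B}[\![\sigma_1]\!]$ and families $y$ with $y_A:\lceil\sigma_1\rceil_A$, $R_{\sigma_1}(x,y)$ implies $R_{\sigma_2}(f\,x,(g_A\,y_A)_A)$. -}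

module Defs where

open import Data.Nat using (ℕ; suc) renaming (zero to 0ℕ)
open import Relation.Binary.PropositionalEquality using (_≡_)

Natrec : {X : Set} → (ℕ → X → X) → X → ℕ → X
Natrec f x 0ℕ = x
Natrec f x (suc n) = f n (Natrec f x n)

infixr 7 _⇒_
data Ty : Set where
  ι   : Ty
  _⇒_ : Ty → Ty → Ty

infixl 5 _▹_
data Ctx : Set where
  ε   : Ctx
  _▹_ : Ctx → Ty → Ctx

data Var : Ctx → Ty → Set where
  vz : ∀ {Γ σ} → Var (Γ ▹ σ) σ
  vs : ∀ {Γ σ τ} → Var Γ σ → Var (Γ ▹ τ) σ

infixl 6 _·_
data Tm (Γ : Ctx) : Ty → Set where
  var  : ∀ {σ} → Var Γ σ → Tm Γ σ
  Zero : Tm Γ ι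
  Succ : Tm Γ ι → Tm Γ ι
  Rec  : ∀ σ → Tm Γ (ι ⇒ σ ⇒ σ) → Tm Γ σ → Tm Γ ι → Tm Γ σ
  Lam  : ∀ {σ τ} → Tm (Γ ▹ σ) τ → Tm Γ (σ ⇒ τ)
  _·_  : ∀ {σ τ} → Tm Γ (σ ⇒ τ) → Tm Γ σ → Tm Γ τ

Ren : Ctx → Ctx → Set
Ren Δ Γ = ∀ {σ} → Var Γ σ → Var Δ σ

liftR : ∀ {Γ Δ τ} → Ren Δ Γ → Ren (Δ ▹ τ) (Γ ▹ τ)
liftR ρ vz = vz
liftR ρ (vs x) = vs (ρ x)

ren : ∀ {Γ Δ σ} → Ren Δ Γ → Tm Γ σ → Tm Δ σ
ren ρ (var x) = var (ρ x)
ren ρ Zero = Zero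
ren ρ (Succ t) = Succ (ren ρ t)
ren ρ (Rec σ t p q) = Rec σ (ren ρ t) (ren ρ p) (ren ρ q)
ren ρ (Lam t) = Lam (ren (liftR ρ) t)
ren ρ (t · u) = ren ρ t · ren ρ u

wk : ∀ {Γ σ τ} → Tm Γ σ → Tm (Γ ▹ τ) σ
wk = ren vs

Sub : Ctx → Ctx → Set
Sub Δ Γ = ∀ {σ} → Var Γ σ → Tm Δ σ

liftS : ∀ {Γ Δ τ} → Sub Δ Γ → Sub (Δ ▹ τ) (Γ ▹ τ)
liftS s vz = var vz
liftS s (vs x) = wk (s x)

sub : ∀ {Γ Δ σ} → Sub Δ Γ → Tm Γ σ → Tm Δ σ
sub s (var x) = s x
sub s Zero = Zero
sub s (Succ t) = Succ (sub s t)
sub s (Rec σ t p q) = Rec σ (sub s t) (sub s p) (sub s q)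
sub s (Lam t) = Lam (sub (liftS s) t)
sub s (t · u) = sub s t · sub s u

⟦_⟧ty : Ty → Set
⟦ ι ⟧ty = ℕ
⟦ σ ⇒ τ ⟧ty = ⟦ σ ⟧ty → ⟦ τ ⟧ty

Env : Ctx → Set
Env Γ = ∀ {σ} → Var Γ σ → ⟦ σ ⟧ty

emptyEnv : Env ε
emptyEnv ()

_,,_ : ∀ {Γ σ} → Env Γ → ⟦ σ ⟧ty → Env (Γ ▹ σ)
(ρ ,, a) vz = a
(ρ ,, a) (vs x) = ρ x

⟦_⟧tm : ∀ {Γ σ} → Tm Γ σ → Env Γ → ⟦ σ ⟧ty
⟦ var x ⟧tm ρ = ρ x
⟦ Zero ⟧tm ρ = 0ℕ
⟦ Succ t ⟧tm ρ = suc (⟦ t ⟧tm ρ)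
⟦ Rec σ t p q ⟧tm ρ = Natrec (⟦ t ⟧tm ρ) (⟦ p ⟧tm ρ) (⟦ q ⟧tm ρ)
⟦ Lam t ⟧tm ρ = λ a → ⟦ t ⟧tm (ρ ,, a)
⟦ t · u ⟧tm ρ = ⟦ t ⟧tm ρ (⟦ u ⟧tm ρ)

⟦_⟧₀ : ∀ {σ} → Tm ε σ → ⟦ σ ⟧ty
⟦ t ⟧₀ = ⟦ t ⟧tm emptyEnv

HEq : (σ : Ty) → ⟦ σ ⟧ty → ⟦ σ ⟧ty → Set
HEq ι n m = n ≡ m
HEq (σ₁ ⇒ σ₂) f g = ∀ x y → HEq σ₁ x y → HEq σ₂ (f x) (g y)

data D : Set where
  η : ℕ → D
  β : (ℕ → D) → ℕ → D

_♯ : (ℕ → D) → D → D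
(f ♯) (η x) = f x
(f ♯) (β φ i) = β (λ o → (f ♯) (φ o)) i

mapD : (ℕ → ℕ) → D → D
mapD f = (λ x → η (f x)) ♯

B⟦_⟧ty : Ty → Set
B⟦ ι ⟧ty = D
B⟦ σ ⇒ τ ⟧ty = B⟦ σ ⟧ty → B⟦ τ ⟧ty

extB : (σ : Ty) → (ℕ → B⟦ σ ⟧ty) → D → B⟦ σ ⟧ty
extB ι f d = (f ♯) d
extB (σ₁ ⇒ σ₂) f d s = extB σ₂ (λ x → f x s) d

BEnv : Ctx → Set
BEnv Γ = ∀ {σ} → Var Γ σ → B⟦ σ ⟧ty

_,,B_ : ∀ {Γ σ} → BEnv Γ → B⟦ σ ⟧ty → BEnv (Γ ▹ σ)
(ρ ,,B a) vz = a
(ρ ,,B a) (vs x) = ρ x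

B⟦_⟧tm : ∀ {Γ σ} → Tm Γ σ → BEnv Γ → B⟦ σ ⟧ty
B⟦ var x ⟧tm γ = γ x
B⟦ Zero ⟧tm γ = η 0ℕ
B⟦ Succ t ⟧tm γ = mapD suc (B⟦ t ⟧tm γ)
B⟦ Rec σ t₁ t₂ t₃ ⟧tm γ =
  extB σ (Natrec (λ n → B⟦ t₁ ⟧tm γ (η n)) (B⟦ t₂ ⟧tm γ)) (B⟦ t₃ ⟧tm γ)
B⟦ Lam t ⟧tm γ = λ a → B⟦ t ⟧tm (γ ,,B a)
B⟦ t · u ⟧tm γ = B⟦ t ⟧tm γ (B⟦ u ⟧tm γ)

ChD : Ty → Ty → Ty
ChD A σ = (σ ⇒ A) ⇒ ((ι ⇒ A) ⇒ ι ⇒ A) ⇒ A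

private
  v0 : ∀ {Γ a} → Tm (Γ ▹ a) a
  v0 = var vz
  v1 : ∀ {Γ a b} → Tm (Γ ▹ a ▹ b) a
  v1 = var (vs vz)
  v2 : ∀ {Γ a b c} → Tm (Γ ▹ a ▹ b ▹ c) a
  v2 = var (vs (vs vz))
  v3 : ∀ {Γ a b c d} → Tm (Γ ▹ a ▹ b ▹ c ▹ d) a
  v3 = var (vs (vs (vs vz)))
  v4 : ∀ {Γ a b c d e} → Tm (Γ ▹ a ▹ b ▹ c ▹ d ▹ e) a
  v4 = var (vs (vs (vs (vs vz))))

-- η_A := λ z e b. e z
ηT : ∀ {Γ} (A : Ty) → Tm Γ (ι ⇒ ChD A ι)
ηT A = Lam (Lam (Lam (v1 · v2)))

-- β_A := λ φ x e b. b (λ y. φ y e b) x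
βT : ∀ {Γ} (A : Ty) → Tm Γ ((ι ⇒ ChD A ι) ⇒ ι ⇒ ChD A ι)
βT A = Lam (Lam (Lam (Lam (v0 · Lam (v4 · v0 · v2 · v1) · v2))))

-- K_A := λ f d e' b'. d (λ x. f x e' b') b'
KT : ∀ {Γ} (A : Ty) → Tm Γ ((ι ⇒ ChD A ι) ⇒ ChD A ι ⇒ ChD A ι)
KT A = Lam (Lam (Lam (Lam (v2 · Lam (v4 · v0 · v2 · v1) · v0))))

mapT : ∀ {Γ} (A : Ty) → Tm Γ ((ι ⇒ ι) ⇒ ChD A ι ⇒ ChD A ι)
mapT A = Lam (KT A · Lam (ηT A · (v1 · v0)))

⌈_⌉ty : Ty → Ty → Ty
⌈ ι ⌉ty A = ChD A ι
⌈ σ ⇒ τ ⌉ty A = ⌈ σ ⌉ty A ⇒ ⌈ τ ⌉ty A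

⌈_⌉ctx : Ctx → Ty → Ctx
⌈ ε ⌉ctx A = ε
⌈ Γ ▹ σ ⌉ctx A = ⌈ Γ ⌉ctx A ▹ ⌈ σ ⌉ty A

⌈_⌉var : ∀ {Γ σ} → Var Γ σ → (A : Ty) → Var (⌈ Γ ⌉ctx A) (⌈ σ ⌉ty A)
⌈ vz ⌉var A = vz
⌈ vs x ⌉var A = vs (⌈ x ⌉var A)

extT : ∀ {Γ} (σ : Ty) (A : Ty) → Tm Γ ((ι ⇒ ⌈ σ ⌉ty A) ⇒ ChD A ι ⇒ ⌈ σ ⌉ty A)
extT ι A = KT A
extT (σ₁ ⇒ σ₂) A = Lam (Lam (Lam (extT σ₂ A · Lam (v3 · v0 · v1) · v1)))

⌈_⌉tm : ∀ {Γ σ} → Tm Γ σ → (A : Ty) → Tm (⌈ Γ ⌉ctx A) (⌈ σ ⌉ty A)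
⌈ var x ⌉tm A = var (⌈ x ⌉var A)
⌈ Zero ⌉tm A = ηT A · Zero
⌈ Succ t ⌉tm A = mapT A · Lam (Succ v0) · ⌈ t ⌉tm A
⌈ Rec σ t₁ t₂ t₃ ⌉tm A =
  extT σ A
    · Lam (Rec (⌈ σ ⌉ty A) (Lam (wk (wk (⌈ t₁ ⌉tm A)) · (ηT A · v0)))
                           (wk (⌈ t₂ ⌉tm A)) v0)
    · ⌈ t₃ ⌉tm A
⌈ Lam t ⌉tm A = Lam (⌈ t ⌉tm A)
⌈ t · u ⌉tm A = ⌈ t ⌉tm A · ⌈ u ⌉tm A

CSub : Ty → Ctx → Set
CSub A Γ = ∀ {τ} → Var Γ τ → Tm ε (⌈ τ ⌉ty A)

toSub : ∀ {A Γ} → CSub A Γ → Sub ε (⌈ Γ ⌉ctx A)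
toSub {A} {Γ ▹ τ} γ vz = γ vz
toSub {A} {Γ ▹ τ} γ (vs x) = toSub {A} {Γ} (λ y → γ (vs y)) x

enc : (A : Ty) → D → ⟦ ChD A ι ⟧ty
enc A (η z) = ⟦ ηT A ⟧₀ z
enc A (β φ x) = ⟦ βT A ⟧₀ (λ o → enc A (φ o)) x

R : (σ : Ty) → B⟦ σ ⟧ty → ((A : Ty) → Tm ε (⌈ σ ⌉ty A)) → Set
R ι d t = ∀ A → HEq (ChD A ι) (enc A d) ⟦ t A ⟧₀
R (σ₁ ⇒ σ₂) f g =
  ∀ (x : B⟦ σ₁ ⟧ty) (y : (A : Ty) → Tm ε (⌈ σ₁ ⌉ty A)) →
  R σ₁ x y → R σ₂ (f x) (λ A → g A · y A)

-- The relation R sees a family of closed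
-- terms only through its set-theoretic meaning up to hereditarily extensional equality, so every
-- case reduces to computing the meaning of a translated term, via the substitution lemma for ⟦_⟧.
-- Two facts carry the content: the internal Kleisli extension K_A commutes with the encoding,
-- enc ∘ g♯ ≈ K_A (enc ∘ g) ∘ enc, which handles succ and ext at base type; and the internal
-- recursor is related to Natrec at every numeral, by induction on the numeral, which suffices
-- because ext reduces recursion on a dialogue tree to recursion at its leaves.
module Submission where

open import Defs
open import Data.Nat using (ℕ; suc) renaming (zero to 0ℕ)
open import Relation.Binary.PropositionalEquality using (_≡_; refl; sym; cong)

HEq-sym : ∀ σ {a b} → HEq σ a b → HEq σ b a
HEq-sym ι p = sym p
HEq-sym (σ ⇒ τ) p x y xy = HEq-sym τ (p y x (HEq-sym σ xy))

HEq-trans : ∀ σ {a b c} → HEq σ a b → HEq σ b c → HEq σ a c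
HEq-trans ι refl q = q
HEq-trans (σ ⇒ τ) p q x y xy =
  HEq-trans τ (p x y xy) (q y y (HEq-trans σ (HEq-sym σ xy) xy))

HEq-reflˡ : ∀ σ {a b} → HEq σ a b → HEq σ a a
HEq-reflˡ σ p = HEq-trans σ p (HEq-sym σ p)

HEq-reflʳ : ∀ σ {a b} → HEq σ a b → HEq σ b b
HEq-reflʳ σ p = HEq-reflˡ σ (HEq-sym σ p)

Natrec-cong : ∀ σ {F F' X X'} → HEq (ι ⇒ σ ⇒ σ) F F' → HEq σ X X' →
  HEq (ι ⇒ σ) (Natrec F X) (Natrec F' X')
Natrec-cong σ FF' XX' 0ℕ .0ℕ refl = XX'
Natrec-cong σ FF' XX' (suc n) .(suc n) refl =
  FF' n n refl _ _ (Natrec-cong σ FF' XX' n n refl)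

HEqEnv : ∀ {Γ} → Env Γ → Env Γ → Set
HEqEnv {Γ} ρ ρ' = ∀ {σ} (x : Var Γ σ) → HEq σ (ρ x) (ρ' x)

HEqEnv-empty : HEqEnv emptyEnv emptyEnv
HEqEnv-empty ()

HEqEnv-,, : ∀ {Γ σ} {ρ ρ' : Env Γ} {a a' : ⟦ σ ⟧ty} →
  HEqEnv ρ ρ' → HEq σ a a' → HEqEnv (ρ ,, a) (ρ' ,, a')
HEqEnv-,, ρρ' aa' vz = aa'
HEqEnv-,, ρρ' aa' (vs x) = ρρ' x

⟦⟧-cong : ∀ {Γ σ} (t : Tm Γ σ) {ρ ρ' : Env Γ} → HEqEnv ρ ρ' →
  HEq σ (⟦ t ⟧tm ρ) (⟦ t ⟧tm ρ')
⟦⟧-cong (var x) ρρ' = ρρ' x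
⟦⟧-cong Zero ρρ' = refl
⟦⟧-cong (Succ t) ρρ' = cong suc (⟦⟧-cong t ρρ')
⟦⟧-cong (Rec σ t p q) ρρ' = Natrec-cong σ (⟦⟧-cong t ρρ') (⟦⟧-cong p ρρ') _ _ (⟦⟧-cong q ρρ')
⟦⟧-cong (Lam t) ρρ' a a' aa' = ⟦⟧-cong t (HEqEnv-,, ρρ' aa')
⟦⟧-cong (t · u) ρρ' = ⟦⟧-cong t ρρ' _ _ (⟦⟧-cong u ρρ')

⟦⟧₀-refl : ∀ {σ} (t : Tm ε σ) → HEq σ ⟦ t ⟧₀ ⟦ t ⟧₀
⟦⟧₀-refl t = ⟦⟧-cong t HEqEnv-empty

≡⇒HEq₀ : ∀ {σ} {t u : Tm ε σ} → t ≡ u → HEq σ ⟦ t ⟧₀ ⟦ u ⟧₀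
≡⇒HEq₀ {t = t} refl = ⟦⟧₀-refl t

ren-sound : ∀ {Γ Δ σ} (r : Ren Δ Γ) (t : Tm Γ σ) {ρ : Env Δ} {ρ' : Env Γ} →
  HEqEnv (λ x → ρ (r x)) ρ' → HEq σ (⟦ ren r t ⟧tm ρ) (⟦ t ⟧tm ρ')
ren-sound r (var x) h = h x
ren-sound r Zero h = refl
ren-sound r (Succ t) h = cong suc (ren-sound r t h)
ren-sound r (Rec σ t p q) h =
  Natrec-cong σ (ren-sound r t h) (ren-sound r p h) _ _ (ren-sound r q h)
ren-sound r (Lam t) h a a' aa' =
  ren-sound (liftR r) t λ { vz → aa' ; (vs x) → h x }
ren-sound r (t · u) h = ren-sound r t h _ _ (ren-sound r u h)

wk-sound : ∀ {Γ σ τ} (t : Tm Γ σ) {ρ : Env Γ} {a : ⟦ τ ⟧ty} → HEqEnv ρ ρ →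
  HEq σ (⟦ wk {τ = τ} t ⟧tm (ρ ,, a)) (⟦ t ⟧tm ρ)
wk-sound t ρρ = ren-sound vs t ρρ

⟦_⟧ˢ : ∀ {Γ Δ} → Sub Δ Γ → Env Δ → Env Γ
⟦ s ⟧ˢ ρ x = ⟦ s x ⟧tm ρ

liftS-HEqEnv : ∀ {Γ Δ σ} (s : Sub Δ Γ) {ρ : Env Δ} {ρ' : Env Γ} {a a' : ⟦ σ ⟧ty} →
  HEqEnv ρ ρ → HEqEnv (⟦ s ⟧ˢ ρ) ρ' → HEq σ a a' →
  HEqEnv (⟦ liftS s ⟧ˢ (ρ ,, a)) (ρ' ,, a')
liftS-HEqEnv s ρρ h aa' vz = aa'
liftS-HEqEnv s ρρ h aa' (vs {σ = τ} x) = HEq-trans τ (wk-sound (s x) ρρ) (h x)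

sub-sound : ∀ {Γ Δ σ} (s : Sub Δ Γ) (t : Tm Γ σ) {ρ : Env Δ} {ρ' : Env Γ} →
  HEqEnv ρ ρ → HEqEnv (⟦ s ⟧ˢ ρ) ρ' → HEq σ (⟦ sub s t ⟧tm ρ) (⟦ t ⟧tm ρ')
sub-sound s (var x) ρρ h = h x
sub-sound s Zero ρρ h = refl
sub-sound s (Succ t) ρρ h = cong suc (sub-sound s t ρρ h)
sub-sound s (Rec σ t p q) ρρ h =
  Natrec-cong σ (sub-sound s t ρρ h) (sub-sound s p ρρ h) _ _ (sub-sound s q ρρ h)
sub-sound s (Lam {σ = σ} t) ρρ h a a' aa' =
  sub-sound (liftS s) t (HEqEnv-,, ρρ (HEq-reflˡ σ aa')) (liftS-HEqEnv s ρρ h aa')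
sub-sound s (t · u) ρρ h = sub-sound s t ρρ h _ _ (sub-sound s u ρρ h)

closedEnv-refl : ∀ {Γ} (s : Sub ε Γ) → HEqEnv (⟦ s ⟧ˢ emptyEnv) (⟦ s ⟧ˢ emptyEnv)
closedEnv-refl s x = ⟦⟧₀-refl (s x)

⟦sub⟧₀ : ∀ {Γ σ} (s : Sub ε Γ) (t : Tm Γ σ) →
  HEq σ ⟦ sub s t ⟧₀ (⟦ t ⟧tm (⟦ s ⟧ˢ emptyEnv))
⟦sub⟧₀ s t = sub-sound s t HEqEnv-empty (closedEnv-refl s)

enc-♯ : ∀ A (g : ℕ → D) (F : ℕ → ⟦ ChD A ι ⟧ty) →
  (∀ n → HEq (ChD A ι) (enc A (g n)) (F n)) →
  ∀ d → HEq (ChD A ι) (enc A ((g ♯) d)) (⟦ KT A ⟧₀ F (enc A d))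
enc-♯ A g F gF (η z) = gF z
enc-♯ A g F gF (β φ x) e e' ee' b b' bb' =
  bb' _ _ (λ { k .k refl → enc-♯ A g F gF (φ k) e e' ee' b b' bb' }) x x refl

enc-♯-cong : ∀ A (g : ℕ → D) (F : ℕ → ⟦ ChD A ι ⟧ty) →
  (∀ n → HEq (ChD A ι) (enc A (g n)) (F n)) →
  ∀ d {c} → HEq (ChD A ι) (enc A d) c → HEq (ChD A ι) (enc A ((g ♯) d)) (⟦ KT A ⟧₀ F c)
enc-♯-cong A g F gF d dc =
  HEq-trans (ChD A ι) (enc-♯ A g F gF d)
    (⟦⟧₀-refl (KT A) F F (λ { n .n refl → HEq-reflʳ (ChD A ι) (gF n) }) (enc A d) _ dc)

enc-mapD : ∀ A (f : ℕ → ℕ) d {c} → HEq (ChD A ι) (enc A d) c →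
  HEq (ChD A ι) (enc A (mapD f d)) (⟦ mapT A ⟧₀ f c)
enc-mapD A f = enc-♯-cong A (λ n → η (f n)) _ (λ n → ⟦⟧₀-refl (ηT A) (f n) (f n) refl)

-- Arguments of functions stay term
-- families, so R σ x t and Rᵛ σ x ⟦t⟧₀ are interderivable, but Rᵛ also applies to meanings
-- that are not (yet) given as terms.
Rᵛ : (σ : Ty) → B⟦ σ ⟧ty → ((A : Ty) → ⟦ ⌈ σ ⌉ty A ⟧ty) → Set
Rᵛ ι d v = ∀ A → HEq (ChD A ι) (enc A d) (v A)
Rᵛ (σ₁ ⇒ σ₂) f v =
  ∀ (x : B⟦ σ₁ ⟧ty) (y : (A : Ty) → Tm ε (⌈ σ₁ ⌉ty A)) →
  R σ₁ x y → Rᵛ σ₂ (f x) (λ A → v A ⟦ y A ⟧₀)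

R⇒Rᵛ : ∀ σ {x t} → R σ x t → Rᵛ σ x (λ A → ⟦ t A ⟧₀)
R⇒Rᵛ ι r = r
R⇒Rᵛ (σ₁ ⇒ σ₂) r x y rxy = R⇒Rᵛ σ₂ (r x y rxy)

Rᵛ⇒R : ∀ σ {x t} → Rᵛ σ x (λ A → ⟦ t A ⟧₀) → R σ x t
Rᵛ⇒R ι r = r
Rᵛ⇒R (σ₁ ⇒ σ₂) r x y rxy = Rᵛ⇒R σ₂ (r x y rxy)

Rᵛ-resp : ∀ σ {x v w} → (∀ A → HEq (⌈ σ ⌉ty A) (v A) (w A)) → Rᵛ σ x v → Rᵛ σ x w
Rᵛ-resp ι vw r A = HEq-trans (ChD A ι) (r A) (vw A)
Rᵛ-resp (σ₁ ⇒ σ₂) vw r x y rxy =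
  Rᵛ-resp σ₂ (λ A → vw A _ _ (⟦⟧₀-refl (y A))) (r x y rxy)

R-resp : ∀ σ {x t u} → (∀ A → HEq (⌈ σ ⌉ty A) ⟦ t A ⟧₀ ⟦ u A ⟧₀) → R σ x t → R σ x u
R-resp σ tu r = Rᵛ⇒R σ (Rᵛ-resp σ tu (R⇒Rᵛ σ r))

extS : (σ A : Ty) → (ℕ → ⟦ ⌈ σ ⌉ty A ⟧ty) → ⟦ ChD A ι ⟧ty → ⟦ ⌈ σ ⌉ty A ⟧ty
extS ι A = ⟦ KT A ⟧₀
extS (σ₁ ⇒ σ₂) A f d s = extS σ₂ A (λ x → f x s) d

⟦extT⟧ : ∀ σ A {Γ} (ρ : Env Γ) →
  HEq ((ι ⇒ ⌈ σ ⌉ty A) ⇒ ChD A ι ⇒ ⌈ σ ⌉ty A) (⟦ extT σ A ⟧tm ρ) (extS σ A)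
⟦extT⟧ ι A ρ = ⟦⟧₀-refl (KT A)
⟦extT⟧ (σ₁ ⇒ σ₂) A ρ f f' ff' d d' dd' s s' ss' =
  ⟦extT⟧ σ₂ A (((ρ ,, f) ,, d) ,, s)
    (λ x → f x s) (λ x → f' x s') (λ n m nm → ff' n m nm s s' ss') d d' dd'

⟦sub-extT⟧ : ∀ σ A {Γ} (s : Sub ε Γ) →
  HEq ((ι ⇒ ⌈ σ ⌉ty A) ⇒ ChD A ι ⇒ ⌈ σ ⌉ty A) ⟦ sub s (extT σ A) ⟧₀ (extS σ A)
⟦sub-extT⟧ σ A s = HEq-trans _ (⟦sub⟧₀ s (extT σ A)) (⟦extT⟧ σ A _)

extS-Rᵛ : ∀ σ (f : ℕ → B⟦ σ ⟧ty) (G : (A : Ty) → ℕ → ⟦ ⌈ σ ⌉ty A ⟧ty) →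
  (∀ n → Rᵛ σ (f n) (λ A → G A n)) →
  ∀ d (c : (A : Ty) → ⟦ ChD A ι ⟧ty) → Rᵛ ι d c →
  Rᵛ σ (extB σ f d) (λ A → extS σ A (G A) (c A))
extS-Rᵛ ι f G fG d c dc A = enc-♯-cong A f (G A) (λ n → fG n A) d (dc A)
extS-Rᵛ (σ₁ ⇒ σ₂) f G fG d c dc x y rxy =
  extS-Rᵛ σ₂ (λ n → f n x) (λ A n → G A n ⟦ y A ⟧₀) (λ n → fG n x y rxy) d c dc

numeral : ℕ → Tm ε ι
numeral 0ℕ = Zero
numeral (suc n) = Succ (numeral n)

⟦numeral⟧ : ∀ n → ⟦ numeral n ⟧₀ ≡ n
⟦numeral⟧ 0ℕ = refl
⟦numeral⟧ (suc n) = cong suc (⟦numeral⟧ n)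

-- λ n. rec (λ x. X₁ (η_A x)) X₂ n, as in the translation of rec.
natrecT : ∀ {Δ} σ A → Tm Δ (⌈ ι ⇒ σ ⇒ σ ⌉ty A) → Tm Δ (⌈ σ ⌉ty A) → Tm Δ (ι ⇒ ⌈ σ ⌉ty A)
natrecT σ A X₁ X₂ =
  Lam (Rec (⌈ σ ⌉ty A) (Lam (wk (wk X₁) · (ηT A · var vz))) (wk X₂) (var vz))

⟦natrecT⟧ : ∀ {Δ} σ A (X₁ : Tm Δ (⌈ ι ⇒ σ ⇒ σ ⌉ty A)) (X₂ : Tm Δ (⌈ σ ⌉ty A))
  {ρ : Env Δ} {Y₁ : ⟦ ⌈ ι ⇒ σ ⇒ σ ⌉ty A ⟧ty} {Y₂ : ⟦ ⌈ σ ⌉ty A ⟧ty} → HEqEnv ρ ρ →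
  HEq _ (⟦ X₁ ⟧tm ρ) Y₁ → HEq _ (⟦ X₂ ⟧tm ρ) Y₂ →
  HEq (ι ⇒ ⌈ σ ⌉ty A) (⟦ natrecT σ A X₁ X₂ ⟧tm ρ) (Natrec (λ k → Y₁ (⟦ ηT A ⟧₀ k)) Y₂)
⟦natrecT⟧ σ A X₁ X₂ {ρ} {Y₁} ρρ XY₁ XY₂ n .n refl =
  Natrec-cong (⌈ σ ⌉ty A) step (HEq-trans (⌈ σ ⌉ty A) (wk-sound X₂ ρρ) XY₂) n n refl
  where
  step : HEq (ι ⇒ ⌈ σ ⌉ty A ⇒ ⌈ σ ⌉ty A)
           (λ k → ⟦ wk (wk X₁) ⟧tm ((ρ ,, n) ,, k) (⟦ ηT A ⟧₀ k)) (λ k → Y₁ (⟦ ηT A ⟧₀ k))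
  step k .k refl =
    HEq-trans _ (wk-sound (wk X₁) (HEqEnv-,, ρρ refl)) (HEq-trans _ (wk-sound X₁ ρρ) XY₁)
      _ _ (⟦⟧₀-refl (ηT A) k k refl)

⟦sub-natrecT⟧ : ∀ σ A {Γ} (s : Sub ε Γ) (X₁ : Tm Γ (⌈ ι ⇒ σ ⇒ σ ⌉ty A)) (X₂ : Tm Γ (⌈ σ ⌉ty A)) →
  HEq (ι ⇒ ⌈ σ ⌉ty A) ⟦ sub s (natrecT σ A X₁ X₂) ⟧₀
    (Natrec (λ k → ⟦ sub s X₁ ⟧₀ (⟦ ηT A ⟧₀ k)) ⟦ sub s X₂ ⟧₀)
⟦sub-natrecT⟧ σ A s X₁ X₂ =
  HEq-trans _ (⟦sub⟧₀ s (natrecT σ A X₁ X₂))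
    (⟦natrecT⟧ σ A X₁ X₂ (closedEnv-refl s)
      (HEq-sym _ (⟦sub⟧₀ s X₁)) (HEq-sym _ (⟦sub⟧₀ s X₂)))

-- The recursive value at n is passed to F (η n) as the term natrecT T₁ T₂ · numeral n.
natrec-Rᵛ : ∀ σ {F : B⟦ ι ⇒ σ ⇒ σ ⟧ty} {X : B⟦ σ ⟧ty}
  (T₁ : (A : Ty) → Tm ε (⌈ ι ⇒ σ ⇒ σ ⌉ty A)) (T₂ : (A : Ty) → Tm ε (⌈ σ ⌉ty A)) →
  R (ι ⇒ σ ⇒ σ) F T₁ → R σ X T₂ →
  ∀ n → Rᵛ σ (Natrec (λ k → F (η k)) X n)
              (λ A → Natrec (λ k → ⟦ T₁ A ⟧₀ (⟦ ηT A ⟧₀ k)) ⟦ T₂ A ⟧₀ n)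
natrec-Rᵛ σ T₁ T₂ FT₁ XT₂ 0ℕ = R⇒Rᵛ σ XT₂
natrec-Rᵛ σ T₁ T₂ FT₁ XT₂ (suc n) =
  Rᵛ-resp σ step
    (R⇒Rᵛ σ (FT₁ (η n) (λ A → ηT A · numeral n) ηR _ (λ A → natrecT σ A (T₁ A) (T₂ A) · numeral n)
      (Rᵛ⇒R σ (Rᵛ-resp σ (λ A → HEq-sym (⌈ σ ⌉ty A) (atNumeral A))
        (natrec-Rᵛ σ T₁ T₂ FT₁ XT₂ n)))))
  where
  ηR : R ι (η n) (λ A → ηT A · numeral n)
  ηR A = ⟦⟧₀-refl (ηT A) n _ (sym (⟦numeral⟧ n))
  atNumeral : ∀ A → HEq (⌈ σ ⌉ty A) (⟦ natrecT σ A (T₁ A) (T₂ A) ⟧₀ ⟦ numeral n ⟧₀)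
                                    (Natrec (λ k → ⟦ T₁ A ⟧₀ (⟦ ηT A ⟧₀ k)) ⟦ T₂ A ⟧₀ n)
  atNumeral A = ⟦natrecT⟧ σ A (T₁ A) (T₂ A) HEqEnv-empty (⟦⟧₀-refl (T₁ A)) (⟦⟧₀-refl (T₂ A))
                  _ _ (⟦numeral⟧ n)
  step : ∀ A → HEq (⌈ σ ⌉ty A)
    (⟦ T₁ A ⟧₀ (⟦ ηT A ⟧₀ ⟦ numeral n ⟧₀) (⟦ natrecT σ A (T₁ A) (T₂ A) ⟧₀ ⟦ numeral n ⟧₀))
    (Natrec (λ k → ⟦ T₁ A ⟧₀ (⟦ ηT A ⟧₀ k)) ⟦ T₂ A ⟧₀ (suc n))
  step A = ⟦⟧₀-refl (T₁ A) _ _ (⟦⟧₀-refl (ηT A) _ _ (⟦numeral⟧ n)) _ _ (atNumeral A)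

Rec-R : ∀ σ {Δ : Ty → Ctx} (s : (A : Ty) → Sub ε (Δ A))
  (X₁ : (A : Ty) → Tm (Δ A) (⌈ ι ⇒ σ ⇒ σ ⌉ty A)) (X₂ : (A : Ty) → Tm (Δ A) (⌈ σ ⌉ty A))
  (X₃ : (A : Ty) → Tm (Δ A) (ChD A ι)) {F : B⟦ ι ⇒ σ ⇒ σ ⟧ty} {X : B⟦ σ ⟧ty} {d : D} →
  R (ι ⇒ σ ⇒ σ) F (λ A → sub (s A) (X₁ A)) → R σ X (λ A → sub (s A) (X₂ A)) →
  R ι d (λ A → sub (s A) (X₃ A)) →
  R σ (extB σ (Natrec (λ k → F (η k)) X) d)
      (λ A → sub (s A) (extT σ A · natrecT σ A (X₁ A) (X₂ A) · X₃ A))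
Rec-R σ s X₁ X₂ X₃ {d = d} FT₁ XT₂ dT₃ =
  Rᵛ⇒R σ (Rᵛ-resp σ (λ A → HEq-sym (⌈ σ ⌉ty A) (meaning A))
    (extS-Rᵛ σ _ _ (natrec-Rᵛ σ _ _ FT₁ XT₂) d _ dT₃))
  where
  meaning : ∀ A → HEq (⌈ σ ⌉ty A)
    ⟦ sub (s A) (extT σ A · natrecT σ A (X₁ A) (X₂ A) · X₃ A) ⟧₀
    (extS σ A (Natrec (λ k → ⟦ sub (s A) (X₁ A) ⟧₀ (⟦ ηT A ⟧₀ k)) ⟦ sub (s A) (X₂ A) ⟧₀)
              ⟦ sub (s A) (X₃ A) ⟧₀)
  meaning A = ⟦sub-extT⟧ σ A (s A) _ _ (⟦sub-natrecT⟧ σ A (s A) (X₁ A) (X₂ A))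
                _ _ (⟦⟧₀-refl (sub (s A) (X₃ A)))

toSub-⌈⌉var : ∀ {A Γ τ} (γ : CSub A Γ) (x : Var Γ τ) → toSub γ (⌈ x ⌉var A) ≡ γ x
toSub-⌈⌉var γ vz = refl
toSub-⌈⌉var γ (vs x) = toSub-⌈⌉var (λ y → γ (vs y)) x

_,,C_ : ∀ {A Γ σ} → CSub A Γ → Tm ε (⌈ σ ⌉ty A) → CSub A (Γ ▹ σ)
(γ ,,C u) vz = u
(γ ,,C u) (vs x) = γ x

toSub-,,C-β : ∀ {A Γ σ τ} (γ : CSub A Γ) (u : Tm ε (⌈ σ ⌉ty A))
  (X : Tm (⌈ Γ ⌉ctx A ▹ ⌈ σ ⌉ty A) τ) →
  HEq τ ⟦ sub (toSub (γ ,,C u)) X ⟧₀ ⟦ Lam (sub (liftS (toSub γ)) X) · u ⟧₀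
toSub-,,C-β {τ = τ} γ u X =
  HEq-trans τ (sub-sound (toSub (γ ,,C u)) X HEqEnv-empty extended)
    (HEq-sym τ (sub-sound (liftS (toSub γ)) X (HEqEnv-,, HEqEnv-empty (⟦⟧₀-refl u))
      (liftS-HEqEnv (toSub γ) HEqEnv-empty (closedEnv-refl (toSub γ)) (⟦⟧₀-refl u))))
  where
  extended : HEqEnv (⟦ toSub (γ ,,C u) ⟧ˢ emptyEnv) (⟦ toSub γ ⟧ˢ emptyEnv ,, ⟦ u ⟧₀)
  extended vz = ⟦⟧₀-refl u
  extended (vs x) = ⟦⟧₀-refl (toSub γ x)

lemma33 : ∀ {Γ σ} (t : Tm Γ σ) (γ₁ : BEnv Γ) (γ₂ : (A : Ty) → CSub A Γ) →
    (∀ {τ} (x : Var Γ τ) → R τ (γ₁ x) (λ A → γ₂ A x)) →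
    R σ (B⟦ t ⟧tm γ₁) (λ A → sub (toSub (γ₂ A)) (⌈ t ⌉tm A))
lemma33 (var {τ} x) γ₁ γ₂ h =
  R-resp τ (λ A → ≡⇒HEq₀ (sym (toSub-⌈⌉var (γ₂ A) x))) (h x)
lemma33 Zero γ₁ γ₂ h A = ⟦⟧₀-refl (ηT A) 0ℕ 0ℕ refl
lemma33 (Succ t) γ₁ γ₂ h A = enc-mapD A suc (B⟦ t ⟧tm γ₁) (lemma33 t γ₁ γ₂ h A)
lemma33 (Rec σ t₁ t₂ t₃) γ₁ γ₂ h =
  Rec-R σ (λ A → toSub (γ₂ A)) (⌈ t₁ ⌉tm) (⌈ t₂ ⌉tm) (⌈ t₃ ⌉tm)
    (lemma33 t₁ γ₁ γ₂ h) (lemma33 t₂ γ₁ γ₂ h) (lemma33 t₃ γ₁ γ₂ h)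
lemma33 (Lam {τ = τ} t) γ₁ γ₂ h x y xy =
  R-resp τ (λ A → toSub-,,C-β (γ₂ A) (y A) (⌈ t ⌉tm A))
    (lemma33 t (γ₁ ,,B x) (λ A → γ₂ A ,,C y A) λ { vz → xy ; (vs v) → h v })
lemma33 (t · u) γ₁ γ₂ h = lemma33 t γ₁ γ₂ h _ _ (lemma33 u γ₁ γ₂ h)
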